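{- Let $m\ge 2$. Let $\mathcal{P}$ be a projective plane of order $m$. For each point $P$ of $\mathcal{P}$ let $\mathcal{A}_P$ be an affine plane of order $m$, and for each line $l$ of $\mathcal{P}$ let $\mathcal{O}_l$ be an orthogonal array $OA(2,m+1,m)$. Let $\mathcal{H}$ be any incidence structure produced by Algorithm 1 (described in the context) from these data and any admissible choices. Then $\mathcal{H}$ is a $2$-uniform $(m,m)$PH-plane.
   Context: An orthogonal array $OA(2,k,v)$ is a $v^2\times k$ array with entries from a set of $v$ symbols such that in any $2$ columns each ordered pair of symbols occurs exactly once. An affine plane of order $m$ has $m^2$ points, $m$ points per line, and its $m^2+m$ lines fall into $m+1$ parallel classes of $m$ pairwise disjoint lines each; a projective plane of order $m$ has $m^2+m+1$ points and lines, $m+1$ points on each line and $m+1$ lines through each point. Algorithm 1. Points of $\mathcal{H}$: all pairs $(P,x)$ with $P$ a point of $\mathcal{P}$ and $x$ a point of $\mathcal{A}_P$ (so $(m^2+m+1)m^2$ points); the set $\{(P,x): x\in\mathcal{A}_P\}$ is the point-neighbourhood of $P$. For each line $l=\{P_0,\dots,P_m\}$ of $\mathcal{P}$: for each $P_i\in l$ choose a parallel class $\pi_{l,P_i}$ of $\mathcal{A}_{P_i}$, in such a way that for each point $P$ the $m+1$ lines of $\mathcal{P}$ through $P$ receive pairwise distinct parallel classes of $\mathcal{A}_P$; choose a bijection between the columns of $\mathcal{O}_l$ and the points of $l$, and for each $i$ a bijection between the $m$ symbols of $\mathcal{O}_l$ and the $m$ lines of $\pi_{l,P_i}$. For each row $r$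 of $\mathcal{O}_l$, form the line of $\mathcal{H}$ consisting of all $(P_i,x)$, $i=0,\dots,m$, such that $x$ lies on the line of $\pi_{l,P_i}$ labelled by the symbol of $\mathcal{O}_l$ in row $r$ and the column corresponding to $P_i$. Doing this for all lines $l$ of $\mathcal{P}$ gives the lines of $\mathcal{H}$, with incidence being membership. A projective Hjelmslev plane is an incidence structure $\mathcal{H}$ together with an epimorphism $\phi$ (an incidence-preserving map, surjective on points and on lines) onto an ordinary projective plane such that: (1) any two points are incident with at least one common line; (2) any two lines have at least one common point; (3) if two lines $g,h$ meet in more than one point then $\phi(g)=\phi(h)$; (4) if two points $P,Q$ lie on more than one common line then $\phi(P)=\phi(Q)$. Points (lines) are called neighbours, $P\sim Q$ ($g\sim h$), iff they have the same image under $\phi$. It is a $(t,r)$PH-plane if every line has exactly $t$ points neighbouring any given one of its points (including itself) and the image projective plane has order $r$. For a point $P$, the point-neighbourhood restriction $\bar P$ is the incidence structure whose points are the points $Q\sim P$ and whose lines are the nonempty sets $g\cap\bar P$ for lines $g$ of $\mathcal{H}$. The plane is $2$-uniform if for every point $P$, $\bar P$ is an ordinary affine plane, and every line of $\bar P$ is the restriction $g\cap \bar P$ of the same number of lines $g$ of $\mathcal{H}$. -}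

module Defs where

open import Data.Nat using (ℕ; suc; _*_; _+_)
open import Data.Fin using (Fin)
open import Data.Product using (Σ; ∃; _×_; _,_; proj₁; proj₂; ∃-syntax; Σ-syntax)
open import Data.Unit using (⊤)
open import Data.Sum using (_⊎_)
open import Relation.Binary.PropositionalEquality using (_≡_; _≢_)
open import Relation.Nullary using (¬_)

-- Counting: "exactly n elements of A satisfy P" via an injective
-- enumeration Fin n → A whose image is exactly {a | P a}.

HasExactly : {A : Set} → (A → Set) → ℕ → Set
HasExactly {A} P n =
  Σ[ f ∈ (Fin n → A) ]
    ((∀ i → P (f i)) ×
     (∀ i j → f i ≡ f j → i ≡ j) ×
     (∀ a → P a → ∃[ i ] (f i ≡ a)))

Size : Set → ℕ → Set
Size A n = HasExactly {A} (λ _ → ⊤) n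

ExactlyOne : {A : Set} → (A → Set) → Set
ExactlyOne {A} P = Σ[ a ∈ A ] (P a × (∀ b → P b → b ≡ a))

record IncidenceStructure : Set₁ where
  field
    Point Line : Set
    _I_ : Point → Line → Set

record ProjectivePlane (m : ℕ) : Set₁ where
  field
    Point Line : Set
    _I_ : Point → Line → Set
    join        : ∀ P Q → P ≢ Q → ∃[ l ] (P I l × Q I l)
    join-unique : ∀ P Q l l' → P ≢ Q → P I l → Q I l → P I l' → Q I l' → l ≡ l'
    meet        : ∀ l l' → l ≢ l' → ∃[ P ] (P I l × P I l')
    meet-unique : ∀ l l' P Q → l ≢ l' → P I l → P I l' → Q I l → Q I l' → P ≡ Q
    quadrangle  : ∃[ A ] ∃[ B ] ∃[ C ] ∃[ D ]
      ((¬ (∃[ l ] (A I l × B I l × C I l))) ×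
       (¬ (∃[ l ] (A I l × B I l × D I l))) ×
       (¬ (∃[ l ] (A I l × C I l × D I l))) ×
       (¬ (∃[ l ] (B I l × C I l × D I l))))
    #points       : Size Point (m * m + m + 1)
    #lines        : Size Line (m * m + m + 1)
    points-on     : ∀ l → HasExactly (λ P → P I l) (suc m)
    lines-through : ∀ P → HasExactly (λ l → P I l) (suc m)

-- Affine planes.  Lines are regarded as point sets: "the same line"
-- means "the same set of points" (needed for neighbourhood restrictions,
-- whose lines are sets g ∩ P̄).

module _ {X L : Set} (_∈_ : X → L → Set) where

  SameLine : L → L → Set
  SameLine g h = ∀ x → (x ∈ g → x ∈ h) × (x ∈ h → x ∈ g)

  Disjoint : L → L → Set
  Disjoint g h = ∀ x → ¬ (x ∈ g × x ∈ h)

  Parallel : L → L → Set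
  Parallel g h = SameLine g h ⊎ Disjoint g h

  record IsAffinePlane : Set where
    field
      two-points      : ∀ g → ∃[ x ] ∃[ y ] (x ≢ y × x ∈ g × y ∈ g)
      join            : ∀ x y → x ≢ y → ∃[ g ] (x ∈ g × y ∈ g)
      join-unique     : ∀ x y g h → x ≢ y → x ∈ g → y ∈ g → x ∈ h → y ∈ h → SameLine g h
      playfair        : ∀ x g → ∃[ h ] (x ∈ h × Parallel h g)
      playfair-unique : ∀ x g h h' → x ∈ h → Parallel h g → x ∈ h' → Parallel h' g → SameLine h h'
      triangle        : ∃[ x ] ∃[ y ] ∃[ z ]
        (x ≢ y × y ≢ z × x ≢ z × ¬ (∃[ g ] (x ∈ g × y ∈ g × z ∈ g)))

record AffinePlane (m : ℕ) : Set₁ where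
  field
    Point Line : Set
    _I_ : Point → Line → Set
    isAffinePlane : IsAffinePlane _I_
    #points   : Size Point (m * m)
    points-on : ∀ g → HasExactly (λ x → x I g) m

record OA (k v : ℕ) : Set where
  field
    entry : Fin (v * v) → Fin k → Fin v
    orth  : ∀ c c' → c ≢ c' → ∀ a b →
            ExactlyOne (λ r → entry r c ≡ a × entry r c' ≡ b)

module _ (H : IncidenceStructure) where
  open IncidenceStructure H

  record PHStructure (r : ℕ) : Set₁ where
    field
      Π  : ProjectivePlane r
      φp : Point → ProjectivePlane.Point Π
      φl : Line → ProjectivePlane.Line Π
      preserves : ∀ P g → P I g → ProjectivePlane._I_ Π (φp P) (φl g)
      surj-p : ∀ P' → ∃[ P ] (φp P ≡ P')
      surj-l : ∀ l' → ∃[ g ] (φl g ≡ l')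
      ax1 : ∀ P Q → ∃[ g ] (P I g × Q I g)
      ax2 : ∀ g h → ∃[ P ] (P I g × P I h)
      ax3 : ∀ g h → (∃[ P ] ∃[ Q ] (P ≢ Q × P I g × P I h × Q I g × Q I h)) → φl g ≡ φl h
      ax4 : ∀ P Q → (∃[ g ] ∃[ h ] (g ≢ h × P I g × Q I g × P I h × Q I h)) → φp P ≡ φp Q

  module _ {r : ℕ} (S : PHStructure r) where
    open PHStructure S

    NeighbourCount : ℕ → Set
    NeighbourCount t = ∀ g P → P I g → HasExactly (λ Q → Q I g × φp Q ≡ φp P) t

    BarPoint : Point → Set
    BarPoint P = Σ[ Q ∈ Point ] (φp Q ≡ φp P)

    -- lines of P̄ are the nonempty sets g ∩ P̄, named by such g
    BarLine : Point → Set
    BarLine P = Σ[ g ∈ Line ] ∃[ Q ] (Q I g × φp Q ≡ φp P)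

    BarMem : (P : Point) → BarPoint P → BarLine P → Set
    BarMem P (Q , _) (g , _) = Q I g

    RestrictsTo : (P : Point) → Line → BarLine P → Set
    RestrictsTo P g β = ∀ Q → φp Q ≡ φp P → (Q I g → Q I proj₁ β) × (Q I proj₁ β → Q I g)

    TwoUniform : Set
    TwoUniform = ∀ P → IsAffinePlane (BarMem P) ×
      ∃[ n ] (∀ β → HasExactly (λ g → RestrictsTo P g β) n)

  TwoUniformPH : ℕ → ℕ → Set₁
  TwoUniformPH t r = Σ[ S ∈ PHStructure r ] (NeighbourCount S t × TwoUniform S)

module _ {m : ℕ} (𝒫 : ProjectivePlane m) (𝒜 : ProjectivePlane.Point 𝒫 → AffinePlane m) where
  open ProjectivePlane 𝒫

  -- choices: for l and P ∈ l, lab l P : symbols → lines of the chosen parallel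
  -- class π_{l,P} of 𝒜_P; col l : points of l → columns of 𝒪_l.
  -- (Values at non-incident pairs are irrelevant.)
  record Choices : Set where
    field
      lab : (l : Line) (P : Point) → Fin m → AffinePlane.Line (𝒜 P)
      col : Line → Point → Fin (suc m)

  module _ (c : Choices) where
    open Choices c

    record Admissible : Set where
      field
        lab-injective : ∀ l P → P I l → ∀ i j →
          SameLine (AffinePlane._I_ (𝒜 P)) (lab l P i) (lab l P j) → i ≡ j
        lab-parallel : ∀ l P → P I l → ∀ i j →
          Parallel (AffinePlane._I_ (𝒜 P)) (lab l P i) (lab l P j)
        lab-full : ∀ l P → P I l → ∀ i h →
          Parallel (AffinePlane._I_ (𝒜 P)) h (lab l P i) →
          ∃[ j ] SameLine (AffinePlane._I_ (𝒜 P)) h (lab l P j)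
        classes-distinct : ∀ P l l' → P I l → P I l' → l ≢ l' → ∀ i j →
          ¬ Parallel (AffinePlane._I_ (𝒜 P)) (lab l P i) (lab l' P j)
        col-injective : ∀ l P Q → P I l → Q I l → col l P ≡ col l Q → P ≡ Q
        col-surjective : ∀ l k → ∃[ P ] (P I l × col l P ≡ k)

  -- the incidence structure produced by Algorithm 1; the line coming from
  -- row r of 𝒪_l is named (l , r)
  algorithm : (ProjectivePlane.Line 𝒫 → OA (suc m) m) → Choices → IncidenceStructure
  algorithm 𝒪 c = record
    { Point = Σ[ P ∈ Point ] AffinePlane.Point (𝒜 P)
    ; Line  = Σ[ l ∈ Line ] Fin (m * m)
    ; _I_   = λ { (P , x) (l , r) → P I l ×
                  AffinePlane._I_ (𝒜 P) x (Choices.lab c l P (OA.entry (𝒪 l) r (Choices.col c l P))) }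
    }

module Submission where

-- The epimorphism is the first projection (P , x) ↦ P, (l , r) ↦ l onto 𝒫.
-- A line (l , r) of H meets the neighbourhood of a point P ∈ l in the line
-- of the labelled parallel class π_{l,P} whose label is the entry of row r
-- in the column of P (its "trace" at P).  All axioms then reduce to three
-- kinds of facts, developed first and in general form:
--   * counting: an injective map from a set at least as large as a finite
--     set A is onto A; consequently a "pencil" of m+1 blocks of m elements
--     through x, pairwise meeting only in x, covers a set of m² elements;
--   * orthogonal arrays: two rows agreeing in two columns coincide, and in
--     an OA(2,m+1,m) any two rows agree in some column (a pencil of rows);
--   * affine planes with m+1 distinct labelled parallel classes: each point
--     lies on one line of each class, lines of distinct classes meet in
--     exactly one point, and the class lines through x cover the plane.

open import Defs
open import Data.Nat using (ℕ; zero; suc; _+_; _*_; _≤_)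
open import Data.Nat.Properties using (*-suc; ≤-refl; ≤-trans; ≤-reflexive; 1+n≰n)
open import Data.Fin using (Fin; zero; suc; punchIn; remQuot; combine)
open import Data.Fin.Properties
  using (_≟_; any?; injective⇒≤; punchIn-injective; punchInᵢ≢i; combine-remQuot)
open import Data.Product using (∃; _×_; _,_; proj₁; proj₂; ∃-syntax; Σ-syntax; uncurry)
open import Data.Sum using (inj₁; inj₂)
open import Data.Unit using (tt)
open import Data.Empty using (⊥; ⊥-elim)
open import Function using (_∘_)
open import Relation.Binary.Definitions using (DecidableEquality)
open import Relation.Binary.PropositionalEquality
  using (_≡_; _≢_; refl; sym; trans; cong; subst)
open import Relation.Nullary using (¬_; yes; no; contradiction)

Fin-size : ∀ n → Size (Fin n) n
Fin-size n = (λ i → i) , (λ _ → tt) , (λ _ _ e → e) , (λ i _ → i , refl)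

module _ {A : Set} {N : ℕ} (size : Size A N) where

  index : A → Fin N
  index a = proj₁ (proj₂ (proj₂ (proj₂ size)) a tt)

  index-injective : ∀ {a b} → index a ≡ index b → a ≡ b
  index-injective {a} {b} e =
    trans (sym (position a)) (trans (cong (proj₁ size) e) (position b))
    where
    position : ∀ a → proj₁ size (index a) ≡ a
    position a = proj₂ (proj₂ (proj₂ (proj₂ size)) a tt)

  size⇒decEq : DecidableEquality A
  size⇒decEq a b with index a ≟ index b
  ... | yes e = yes (index-injective e)
  ... | no ne = no (ne ∘ cong index)

  -- An injective map into A from a set with at least N elements is onto:
  -- a missed y would give an injection of Fin (1 + a) into Fin N.
  injective⇒surjective : ∀ {a} → N ≤ a → (F : Fin a → A) →
    (∀ i j → F i ≡ F j → i ≡ j) → ∀ y → ∃[ i ] F i ≡ y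
  injective⇒surjective {a} N≤a F F-inj y with any? (λ i → size⇒decEq (F i) y)
  ... | yes hit = hit
  ... | no miss = contradiction (≤-trans (injective⇒≤ G-inj) N≤a) 1+n≰n
    where
    G : Fin (suc a) → Fin N
    G zero = index y
    G (suc i) = index (F i)

    G-inj : ∀ {i j} → G i ≡ G j → i ≡ j
    G-inj {zero}  {zero}  _ = refl
    G-inj {zero}  {suc j} e = ⊥-elim (miss (j , sym (index-injective e)))
    G-inj {suc i} {zero}  e = ⊥-elim (miss (i , index-injective e))
    G-inj {suc i} {suc j} e = cong suc (F-inj i j (index-injective e))

remQuot-injective : ∀ {a} b (u v : Fin (a * b)) → remQuot {a} b u ≡ remQuot b v → u ≡ v
remQuot-injective {a} b u v e =
  trans (sym (combine-remQuot {a} b u))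
        (trans (cong (uncurry combine) e) (combine-remQuot {a} b v))

square-as-pencil : ∀ n → suc n * suc n ≡ suc (suc (suc n) * n)
square-as-pencil n = cong (λ t → suc (n + t)) (*-suc n n)

-- A pencil of m+1 blocks, each an injective family of m elements containing
-- x, any two meeting only in x, covers a set of m² elements: besides x it
-- already contains (m + 1)(m - 1) distinct elements.
module _ {A : Set} {n : ℕ} (size : Size A (suc n * suc n)) (x : A)
  (block : Fin (suc (suc n)) → Fin (suc n) → A)
  (block-injective : ∀ i j j' → block i j ≡ block i j' → j ≡ j')
  (centre : Fin (suc (suc n)) → Fin (suc n))
  (centre-is-x : ∀ i → block i (centre i) ≡ x)
  (meet-only-in-x : ∀ i i' j j' → i ≢ i' → block i j ≡ block i' j' → block i j ≡ x)
  where

  private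
    rest : Fin (suc (suc n)) × Fin n → A
    rest (i , j) = block i (punchIn (centre i) j)

    rest≢x : ∀ p → rest p ≢ x
    rest≢x (i , j) e =
      punchInᵢ≢i (centre i) j (block-injective i _ _ (trans e (sym (centre-is-x i))))

    rest-injective : ∀ p q → rest p ≡ rest q → p ≡ q
    rest-injective (i , j) (i' , j') e with i ≟ i'
    ... | yes refl = cong (i ,_) (punchIn-injective (centre i) j j' (block-injective i _ _ e))
    ... | no i≢i' = ⊥-elim (rest≢x (i , j) (meet-only-in-x i i' _ _ i≢i' e))

    pencil : Fin (suc (suc (suc n) * n)) → A
    pencil zero = x
    pencil (suc k) = rest (remQuot n k)

    pencil-injective : ∀ k k' → pencil k ≡ pencil k' → k ≡ k'
    pencil-injective zero    zero     _ = refl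
    pencil-injective zero    (suc k') e = ⊥-elim (rest≢x _ (sym e))
    pencil-injective (suc k) zero     e = ⊥-elim (rest≢x _ e)
    pencil-injective (suc k) (suc k') e =
      cong suc (remQuot-injective {suc (suc n)} n k k' (rest-injective _ _ e))

  pencil-covers : ∀ y → ∃[ i ] ∃[ j ] block i j ≡ y
  pencil-covers y with injective⇒surjective size (≤-reflexive (square-as-pencil n))
                         pencil pencil-injective y
  ... | zero  , x≡y = zero , centre zero , trans (centre-is-x zero) x≡y
  ... | suc k , e = proj₁ (remQuot n k) , punchIn _ (proj₂ (remQuot n k)) , e

rows-agreeing-twice : ∀ {k v} (O : OA k v) → let open OA O in
  ∀ c c' → c ≢ c' → ∀ r r' → entry r c ≡ entry r' c → entry r c' ≡ entry r' c' → r ≡ r'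
rows-agreeing-twice O c c' c≢c' r r' e e' =
  let (_ , _ , unique) = OA.orth O c c' c≢c' (OA.entry O r c) (OA.entry O r c')
  in trans (unique r (refl , refl)) (sym (unique r' (sym e , sym e')))

partner : ∀ {j} → Fin (suc (suc j)) → Fin (suc (suc j))
partner zero = suc zero
partner (suc _) = zero

partner-≢ : ∀ {j} (c : Fin (suc (suc j))) → c ≢ partner c
partner-≢ zero ()
partner-≢ (suc _) ()

module _ {j v : ℕ} (O : OA (suc (suc j)) v) where
  open OA O

  rowWith : Fin (suc (suc j)) → Fin v → Fin v → Fin (v * v)
  rowWith c a b = proj₁ (orth c (partner c) (partner-≢ c) a b)

  rowWith-column : ∀ c a b → entry (rowWith c a b) c ≡ a
  rowWith-column c a b = proj₁ (proj₁ (proj₂ (orth c (partner c) (partner-≢ c) a b)))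

  rowWith-partner : ∀ c a b → entry (rowWith c a b) (partner c) ≡ b
  rowWith-partner c a b = proj₂ (proj₁ (proj₂ (orth c (partner c) (partner-≢ c) a b)))

  rowWith-injective : ∀ c a b b' → rowWith c a b ≡ rowWith c a b' → b ≡ b'
  rowWith-injective c a b b' e = trans (sym (rowWith-partner c a b))
    (trans (cong (λ s → entry s (partner c)) e) (rowWith-partner c a b'))

  rowWith-entries : ∀ c r → rowWith c (entry r c) (entry r (partner c)) ≡ r
  rowWith-entries c r = rows-agreeing-twice O c (partner c) (partner-≢ c) _ r
    (rowWith-column c _ _) (rowWith-partner c _ _)

-- In an OA(2,m+1,m) any two rows agree in some column: the rows agreeing
-- with r in column c, indexed by their partner entry, form a pencil through r.
rows-agree : ∀ {n} (O : OA (suc (suc n)) (suc n)) → let open OA O in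
  ∀ r r' → ∃[ c ] entry r' c ≡ entry r c
rows-agree {n} O r r' =
  let (c , b , e) = pencil-covers (Fin-size _) r block (λ c → rowWith-injective O c _)
                      (λ c → entry r (partner c)) (λ c → rowWith-entries O c r)
                      meet-only-in-r r'
  in c , subst (λ s → entry s c ≡ entry r c) e (rowWith-column O c _ b)
  where
  open OA O

  block : Fin (suc (suc n)) → Fin (suc n) → Fin (suc n * suc n)
  block c = rowWith O c (entry r c)

  meet-only-in-r : ∀ c c' b b' → c ≢ c' → block c b ≡ block c' b' → block c b ≡ r
  meet-only-in-r c c' b b' c≢c' e = rows-agreeing-twice O c c' c≢c' _ r
    (rowWith-column O c _ b)
    (trans (cong (λ s → entry s c') e) (rowWith-column O c' _ b'))

module LabelledClasses {n : ℕ} (A : AffinePlane (suc n)) {K : Set} (Holds : K → Set)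
  (lab : K → Fin (suc n) → AffinePlane.Line A)
  (lab-injective : ∀ k → Holds k → ∀ i j →
    SameLine (AffinePlane._I_ A) (lab k i) (lab k j) → i ≡ j)
  (lab-parallel : ∀ k → Holds k → ∀ i j → Parallel (AffinePlane._I_ A) (lab k i) (lab k j))
  (lab-full : ∀ k → Holds k → ∀ i h →
    Parallel (AffinePlane._I_ A) h (lab k i) → ∃[ j ] SameLine (AffinePlane._I_ A) h (lab k j))
  (classes-distinct : ∀ k k' → Holds k → Holds k' → k ≢ k' → ∀ i j →
    ¬ Parallel (AffinePlane._I_ A) (lab k i) (lab k' j))
  where

  open AffinePlane A
  open IsAffinePlane isAffinePlane

  -- the label of the line of class k through x (the parallel to any line
  -- of the class through x belongs to the class)
  classOf : ∀ k → Holds k → Point → Fin (suc n)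
  classOf k hk x = proj₁ (lab-full k hk zero _ (proj₂ (proj₂ (playfair x (lab k zero)))))

  on-classOf : ∀ k (hk : Holds k) x → x I lab k (classOf k hk x)
  on-classOf k hk x =
    let (h , x∈h , h∥) = playfair x (lab k zero)
    in proj₁ (proj₂ (lab-full k hk zero h h∥) x) x∈h

  class-unique : ∀ k → Holds k → ∀ x a b → x I lab k a → x I lab k b → a ≡ b
  class-unique k hk x a b x∈a x∈b with lab-parallel k hk a b
  ... | inj₁ same = lab-injective k hk a b same
  ... | inj₂ disjoint = ⊥-elim (disjoint x (x∈a , x∈b))

  cross-meet-once : ∀ k k' → Holds k → Holds k' → k ≢ k' → ∀ a b x y → x ≢ y →
    x I lab k a → y I lab k a → x I lab k' b → y I lab k' b → ⊥
  cross-meet-once k k' hk hk' k≢k' a b x y x≢y x∈a y∈a x∈b y∈b =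
    classes-distinct k k' hk hk' k≢k' a b (inj₁ (join-unique x y _ _ x≢y x∈a y∈a x∈b y∈b))

  -- lines of distinct classes meet: the m points of lab k a lie on m
  -- distinct lines of class k', which are therefore all of them
  cross-meet : ∀ k k' → Holds k → Holds k' → k ≢ k' → ∀ a b →
    ∃[ x ] (x I lab k a × x I lab k' b)
  cross-meet k k' hk hk' k≢k' a b =
    let (i , e) = injective⇒surjective (Fin-size _) ≤-refl label-of label-injective b
    in pt i , pt-on i , subst (λ s → pt i I lab k' s) e (on-classOf k' hk' (pt i))
    where
    pt : Fin (suc n) → Point
    pt = proj₁ (points-on (lab k a))

    pt-on : ∀ i → pt i I lab k a
    pt-on = proj₁ (proj₂ (points-on (lab k a)))

    pt-injective : ∀ i j → pt i ≡ pt j → i ≡ j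
    pt-injective = proj₁ (proj₂ (proj₂ (points-on (lab k a))))

    label-of : Fin (suc n) → Fin (suc n)
    label-of i = classOf k' hk' (pt i)

    label-injective : ∀ i j → label-of i ≡ label-of j → i ≡ j
    label-injective i j e with size⇒decEq #points (pt i) (pt j)
    ... | yes same = pt-injective i j same
    ... | no differ = ⊥-elim (cross-meet-once k k' hk hk' k≢k' a (label-of i) _ _ differ
            (pt-on i) (pt-on j) (on-classOf k' hk' (pt i))
            (subst (λ s → pt j I lab k' s) (sym e) (on-classOf k' hk' (pt j))))

  -- given m+1 classes, every point y lies on the line through x of one of
  -- them: these lines form a pencil through x in the m² points
  classes-cover : HasExactly Holds (suc (suc n)) → ∀ x y →
    ∃[ k ] Σ[ hk ∈ Holds k ] y I lab k (classOf k hk x)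
  classes-cover (κ , κ-holds , κ-injective , _) x y =
    let (i , j , e) = pencil-covers #points x block block-injective centre centre-is-x
                        meet-only-in-x y
    in κ i , κ-holds i , subst (λ z → z I line i) e (block-on i j)
    where
    line : Fin (suc (suc n)) → Line
    line i = lab (κ i) (classOf (κ i) (κ-holds i) x)

    x-on : ∀ i → x I line i
    x-on i = on-classOf (κ i) (κ-holds i) x

    block : Fin (suc (suc n)) → Fin (suc n) → Point
    block i = proj₁ (points-on (line i))

    block-on : ∀ i j → block i j I line i
    block-on i = proj₁ (proj₂ (points-on (line i)))

    block-injective : ∀ i j j' → block i j ≡ block i j' → j ≡ j'
    block-injective i = proj₁ (proj₂ (proj₂ (points-on (line i))))

    centre : Fin (suc (suc n)) → Fin (suc n)
    centre i = proj₁ (proj₂ (proj₂ (proj₂ (points-on (line i)))) x (x-on i))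

    centre-is-x : ∀ i → block i (centre i) ≡ x
    centre-is-x i = proj₂ (proj₂ (proj₂ (proj₂ (points-on (line i)))) x (x-on i))

    meet-only-in-x : ∀ i i' j j' → i ≢ i' → block i j ≡ block i' j' → block i j ≡ x
    meet-only-in-x i i' j j' i≢i' e with size⇒decEq #points (block i j) x
    ... | yes is-x = is-x
    ... | no not-x = ⊥-elim (cross-meet-once (κ i) (κ i') (κ-holds i) (κ-holds i')
            (i≢i' ∘ κ-injective i i') _ _ _ _ not-x (block-on i j) (x-on i)
            (subst (λ z → z I line i') (sym e) (block-on i' j')) (x-on i'))

module Construction {n : ℕ} (𝒫 : ProjectivePlane (suc n))
  (𝒜 : ProjectivePlane.Point 𝒫 → AffinePlane (suc n))
  (𝒪 : ProjectivePlane.Line 𝒫 → OA (suc (suc n)) (suc n))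
  (c : Choices 𝒫 𝒜) (adm : Admissible 𝒫 𝒜 c) where

  open ProjectivePlane 𝒫
  open Choices c
  open Admissible adm

  H : IncidenceStructure
  H = algorithm 𝒫 𝒜 𝒪 c

  open IncidenceStructure H using () renaming (Point to HPoint; _I_ to _∈H_)

  On : (P : Point) → AffinePlane.Point (𝒜 P) → AffinePlane.Line (𝒜 P) → Set
  On P = AffinePlane._I_ (𝒜 P)

  syntax On P x g = x ∈[ P ] g

  decP : DecidableEquality Point
  decP = size⇒decEq #points

  decL : DecidableEquality Line
  decL = size⇒decEq #lines

  symbol : Line → Fin (suc n * suc n) → Point → Fin (suc n)
  symbol l r P = OA.entry (𝒪 l) r (col l P)

  -- the points of the line (l , r) of H neighbouring P ∈ l are those of
  -- its trace, by the very definition of incidence in H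
  trace : Line → Fin (suc n * suc n) → (P : Point) → AffinePlane.Line (𝒜 P)
  trace l r P = lab l P (symbol l r P)

  relabel : ∀ {P l a b} x → a ≡ b → x ∈[ P ] lab l P a → x ∈[ P ] lab l P b
  relabel {P} {l} x e = subst (λ s → x ∈[ P ] lab l P s) e

  equal-symbols⇒same-trace : ∀ {P l r r'} → symbol l r P ≡ symbol l r' P →
    SameLine (On P) (trace l r P) (trace l r' P)
  equal-symbols⇒same-trace e x = relabel x e , relabel x (sym e)

  module Classes (P : Point) = LabelledClasses (𝒜 P) (λ l → P I l) (λ l → lab l P)
    (λ l → lab-injective l P) (λ l → lab-parallel l P) (λ l → lab-full l P)
    (classes-distinct P)
  open Classes using (classOf; on-classOf; class-unique; cross-meet-once; cross-meet; classes-cover)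

  rowAt : Line → Point → Fin (suc n) → Fin (suc n * suc n)
  rowAt l P a = rowWith (𝒪 l) (col l P) a zero

  rowAt-symbol : ∀ l P a → symbol l (rowAt l P a) P ≡ a
  rowAt-symbol l P a = rowWith-column (𝒪 l) (col l P) a zero

  col-≢ : ∀ l {P Q} → P I l → Q I l → P ≢ Q → col l P ≢ col l Q
  col-≢ l Pl Ql P≢Q e = P≢Q (col-injective l _ _ Pl Ql e)

  pointOn : (P : Point) (g : AffinePlane.Line (𝒜 P)) → ∃[ x ] x ∈[ P ] g
  pointOn P g = let (pt , pt-on , _) = AffinePlane.points-on (𝒜 P) g in pt zero , pt-on zero

  second-injective : ∀ {P} {u v : AffinePlane.Point (𝒜 P)} →
    _≡_ {A = HPoint} (P , u) (P , v) → u ≡ v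
  second-injective refl = refl

  -- any two points of 𝒜_P lie on a common trace at P: the class line
  -- through x of some line l ∋ P contains y
  neighbours-joined : ∀ P x y →
    ∃[ l ] ∃[ r ] (P I l × x ∈[ P ] trace l r P × y ∈[ P ] trace l r P)
  neighbours-joined P x y =
    let (l , Pl , y-on) = classes-cover P (lines-through P) x y
        e = sym (rowAt-symbol l P (classOf P l Pl x))
    in l , rowAt l P _ , Pl , relabel x e (on-classOf P l Pl x) , relabel y e y-on

  -- (1) any two points of H are joined: neighbours by a common trace,
  -- non-neighbours P ≠ Q by the row of 𝒪_{PQ} with their class symbols
  joined : ∀ p q → ∃[ g ] (p ∈H g × q ∈H g)
  joined (P , x) (Q , y) with decP P Q
  ... | yes refl =
    let (l , r , Pl , x-on , y-on) = neighbours-joined P x y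
    in (l , r) , (Pl , x-on) , (Pl , y-on)
  ... | no P≢Q =
    let (l , Pl , Ql) = join P Q P≢Q
        (r , (eP , eQ) , _) = OA.orth (𝒪 l) (col l P) (col l Q) (col-≢ l Pl Ql P≢Q)
                                (classOf P l Pl x) (classOf Q l Ql y)
    in (l , r) , (Pl , relabel x (sym eP) (on-classOf P l Pl x))
               , (Ql , relabel y (sym eQ) (on-classOf Q l Ql y))

  -- (2) any two lines of H meet: over one line of 𝒫 at a point whose column
  -- the rows agree in, over distinct lines in the neighbourhood of their
  -- meet, where their traces lie in distinct classes
  meeting : ∀ g h → ∃[ p ] (p ∈H g × p ∈H h)
  meeting (l , r) (l' , r') with decL l l'
  ... | yes refl =
    let (k , agree) = rows-agree (𝒪 l) r' r
        (P , Pl , colP) = col-surjective l k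
        (x , x-on) = pointOn P (trace l r P)
        same = subst (λ k → OA.entry (𝒪 l) r k ≡ OA.entry (𝒪 l) r' k) (sym colP) agree
    in (P , x) , (Pl , x-on) , (Pl , relabel x same x-on)
  ... | no l≢l' =
    let (P , Pl , Pl') = meet l l' l≢l'
        (x , x-on , x-on') = cross-meet P l l' Pl Pl' l≢l' _ _
    in (P , x) , (Pl , x-on) , (Pl' , x-on')

  lines-sharing-two-points : ∀ g h →
    (∃[ p ] ∃[ q ] (p ≢ q × p ∈H g × p ∈H h × q ∈H g × q ∈H h)) → proj₁ g ≡ proj₁ h
  lines-sharing-two-points (l , r) (l' , r')
    ((P , x) , (Q , y) , p≢q , (Pl , x-on) , (Pl' , x-on') , (Ql , y-on) , (Ql' , y-on'))
    with decP P Q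
  ... | no P≢Q = join-unique P Q l l' P≢Q Pl Ql Pl' Ql'
  ... | yes refl with decL l l'
  ...   | yes same = same
  ...   | no l≢l' = ⊥-elim (cross-meet-once P l l' Pl Pl' l≢l' _ _ x y (p≢q ∘ cong (P ,_))
                      x-on y-on x-on' y-on')

  -- (4) points of H on two common lines lie over the same point of 𝒫: two
  -- rows through non-neighbours P, Q agree in the columns of P and Q
  points-on-two-lines : ∀ p q →
    (∃[ g ] ∃[ h ] (g ≢ h × p ∈H g × q ∈H g × p ∈H h × q ∈H h)) → proj₁ p ≡ proj₁ q
  points-on-two-lines (P , x) (Q , y)
    ((l , r) , (l' , r') , g≢h , (Pl , x-on) , (Ql , y-on) , (Pl' , x-on') , (Ql' , y-on'))
    with decP P Q
  ... | yes same = same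
  ... | no P≢Q with join-unique P Q l l' P≢Q Pl Ql Pl' Ql'
  ...   | refl = ⊥-elim (g≢h (cong (l ,_)
                   (rows-agreeing-twice (𝒪 l) (col l P) (col l Q) (col-≢ l Pl Ql P≢Q) r r'
                     (class-unique P l Pl x _ _ x-on x-on')
                     (class-unique Q l Ql y _ _ y-on y-on'))))

  ph : PHStructure H (suc n)
  ph = record
    { Π = 𝒫 ; φp = proj₁ ; φl = proj₁
    ; preserves = λ _ _ → proj₁
    ; surj-p = λ P → (P , proj₁ (AffinePlane.#points (𝒜 P)) zero) , refl
    ; surj-l = λ l → (l , zero) , refl
    ; ax1 = joined ; ax2 = meeting
    ; ax3 = lines-sharing-two-points ; ax4 = points-on-two-lines }

  -- the neighbours of P on a line of H are the m points of its trace at P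
  neighbour-count : NeighbourCount H ph (suc n)
  neighbour-count (l , r) (P , _) (Pl , _) = lift (AffinePlane.points-on (𝒜 P) (trace l r P))
    where
    lift : HasExactly (λ x → x ∈[ P ] trace l r P) (suc n) →
           HasExactly (λ q → q ∈H (l , r) × proj₁ q ≡ P) (suc n)
    lift (pt , pt-on , pt-injective , pt-onto) =
      (λ i → P , pt i) , (λ i → (Pl , pt-on i) , refl) ,
      (λ i j e → pt-injective i j (second-injective e)) ,
      λ { (_ , y) ((_ , y-on) , refl) → let (i , e) = pt-onto y y-on in i , cong (P ,_) e }

  -- The restriction P̄₀ of H to the neighbourhood of (P₀ , x₀) is a copy of
  -- 𝒜_{P₀} whose lines are the traces at P₀.
  module Neighbourhood (P₀ : Point) (x₀ : AffinePlane.Point (𝒜 P₀)) where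

    BPoint : Set
    BPoint = BarPoint H ph (P₀ , x₀)

    BLine : Set
    BLine = BarLine H ph (P₀ , x₀)

    _∈B_ : BPoint → BLine → Set
    _∈B_ = BarMem H ph (P₀ , x₀)

    bar : AffinePlane.Point (𝒜 P₀) → BPoint
    bar v = (P₀ , v) , refl

    bar-injective : ∀ {u v} → bar u ≡ bar v → u ≡ v
    bar-injective e = second-injective (cong proj₁ e)

    barLine : ∀ l r → P₀ I l → ∀ v → v ∈[ P₀ ] trace l r P₀ → BLine
    barLine l r Pl v v-on = (l , r) , ((P₀ , v) , (Pl , v-on) , refl)

    through : (β : BLine) → P₀ I proj₁ (proj₁ β)
    through ((l , r) , ((_ , _) , (Pl , _) , refl)) = Pl

    traceOf : BLine → AffinePlane.Line (𝒜 P₀)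
    traceOf ((l , r) , _) = trace l r P₀

    same⇒same-trace : ∀ β γ → SameLine _∈B_ β γ → SameLine (On P₀) (traceOf β) (traceOf γ)
    same⇒same-trace β γ s v =
      (λ v-on → proj₂ (proj₁ (s (bar v)) (through β , v-on))) ,
      (λ v-on → proj₂ (proj₂ (s (bar v)) (through γ , v-on)))

    same-trace⇒same : ∀ β γ → SameLine (On P₀) (traceOf β) (traceOf γ) → SameLine _∈B_ β γ
    same-trace⇒same β γ s ((_ , v) , refl) =
      (λ (_ , v-on) → through γ , proj₁ (s v) v-on) ,
      (λ (_ , v-on) → through β , proj₂ (s v) v-on)

    parallel⇒parallel-trace : ∀ β γ → Parallel _∈B_ β γ →
      Parallel (On P₀) (traceOf β) (traceOf γ)
    parallel⇒parallel-trace β γ (inj₁ s) = inj₁ (same⇒same-trace β γ s)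
    parallel⇒parallel-trace β γ (inj₂ d) =
      inj₂ (λ v (v-on , v-on') → d (bar v) ((through β , v-on) , (through γ , v-on')))

    parallel-trace⇒parallel : ∀ β γ → Parallel (On P₀) (traceOf β) (traceOf γ) →
      Parallel _∈B_ β γ
    parallel-trace⇒parallel β γ (inj₁ s) = inj₁ (same-trace⇒same β γ s)
    parallel-trace⇒parallel β γ (inj₂ d) =
      inj₂ λ { ((_ , v) , refl) ((_ , v-on) , (_ , v-on')) → d v (v-on , v-on') }

    common-point⇒same : ∀ l r r' wg wh v → v ∈[ P₀ ] trace l r P₀ → v ∈[ P₀ ] trace l r' P₀ →
      SameLine _∈B_ ((l , r) , wg) ((l , r') , wh)
    common-point⇒same l r r' wg wh v v-on v-on' =
      same-trace⇒same ((l , r) , wg) ((l , r') , wh)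
        (equal-symbols⇒same-trace (class-unique P₀ l (through ((l , r) , wg)) v _ _ v-on v-on'))

    -- parallel lines of P̄₀ lie over the same line of 𝒫, since distinct
    -- lines through P₀ carry distinct parallel classes
    parallel⇒same-base : ∀ β γ → Parallel _∈B_ β γ → proj₁ (proj₁ β) ≡ proj₁ (proj₁ γ)
    parallel⇒same-base β γ par with decL (proj₁ (proj₁ β)) (proj₁ (proj₁ γ))
    ... | yes same = same
    ... | no differ = ⊥-elim (classes-distinct P₀ _ _ (through β) (through γ) differ _ _
                        (parallel⇒parallel-trace β γ par))

    bar-two-points : ∀ β → ∃[ u ] ∃[ v ] (u ≢ v × u ∈B β × v ∈B β)
    bar-two-points β =
      let (u , v , u≢v , u-on , v-on) = IsAffinePlane.two-points
                                           (AffinePlane.isAffinePlane (𝒜 P₀)) (traceOf β)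
      in bar u , bar v , u≢v ∘ bar-injective , (through β , u-on) , (through β , v-on)

    bar-join : ∀ p q → p ≢ q → ∃[ β ] (p ∈B β × q ∈B β)
    bar-join ((_ , u) , refl) ((_ , v) , refl) _ =
      let (l , r , Pl , u-on , v-on) = neighbours-joined P₀ u v
      in barLine l r Pl u u-on , (Pl , u-on) , (Pl , v-on)

    bar-join-unique : ∀ p q β γ → p ≢ q → p ∈B β → q ∈B β → p ∈B γ → q ∈B γ → SameLine _∈B_ β γ
    bar-join-unique ((_ , u) , refl) ((_ , v) , refl) ((l , r) , wβ) ((l' , r') , wγ) p≢q
      (Pl , u-on) (_ , v-on) (Pl' , u-on') (_ , v-on') with decL l l'
    ... | yes refl = common-point⇒same l r r' wβ wγ u u-on u-on'
    ... | no l≢l' = ⊥-elim (cross-meet-once P₀ l l' Pl Pl' l≢l' _ _ u v (p≢q ∘ cong bar)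
                      u-on v-on u-on' v-on')

    -- the parallel through u is the line of the same class through u
    bar-playfair : ∀ p β → ∃[ γ ] (p ∈B γ × Parallel _∈B_ γ β)
    bar-playfair ((_ , u) , refl) β@((l , r) , _) =
      let Pl = through β
          u-on = relabel u (sym (rowAt-symbol l P₀ _)) (on-classOf P₀ l Pl u)
          γ = barLine l (rowAt l P₀ (classOf P₀ l Pl u)) Pl u u-on
      in γ , (Pl , u-on) , parallel-trace⇒parallel γ β (lab-parallel l P₀ Pl _ _)

    bar-playfair-unique : ∀ p β γ γ' → p ∈B γ → Parallel _∈B_ γ β → p ∈B γ' →
      Parallel _∈B_ γ' β → SameLine _∈B_ γ γ'
    bar-playfair-unique ((_ , u) , refl) β γ@((l , r) , wγ) γ'@((l' , r') , wγ')
      (_ , u-on) γ∥β (_ , u-on') γ'∥β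
      with parallel⇒same-base γ β γ∥β | parallel⇒same-base γ' β γ'∥β
    ... | refl | refl = common-point⇒same l r r' wγ wγ' u u-on u-on'

    bar-triangle : ∃[ p ] ∃[ q ] ∃[ s ]
      (p ≢ q × q ≢ s × p ≢ s × ¬ (∃[ β ] (p ∈B β × q ∈B β × s ∈B β)))
    bar-triangle =
      let (u , v , w , u≢v , v≢w , u≢w , not-collinear) =
            IsAffinePlane.triangle (AffinePlane.isAffinePlane (𝒜 P₀))
      in bar u , bar v , bar w , u≢v ∘ bar-injective , v≢w ∘ bar-injective , u≢w ∘ bar-injective ,
         λ (β , (_ , u-on) , (_ , v-on) , (_ , w-on)) →
           not-collinear (traceOf β , u-on , v-on , w-on)

    isAffinePlane : IsAffinePlane _∈B_
    isAffinePlane = record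
      { two-points = bar-two-points ; join = bar-join ; join-unique = bar-join-unique
      ; playfair = bar-playfair ; playfair-unique = bar-playfair-unique ; triangle = bar-triangle }

    -- the lines of H restricting to β are the m rows of 𝒪_l carrying the
    -- symbol of β in the column of P₀, indexed by their partner entry
    restriction-count : ∀ β → HasExactly (λ g → RestrictsTo H ph (P₀ , x₀) g β) (suc n)
    restriction-count β@((l , r) , ((_ , y) , (Pl , y-on) , refl)) =
      row , restricts , (λ j j' e → rowWith-injective (𝒪 l) k a j j' (cong proj₂ e)) , only
      where
      k : Fin (suc (suc n))
      k = col l P₀

      a : Fin (suc n)
      a = symbol l r P₀

      row : Fin (suc n) → Line × Fin (suc n * suc n)
      row j = l , rowWith (𝒪 l) k a j

      restricts : ∀ j → RestrictsTo H ph (P₀ , x₀) (row j) β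
      restricts j (_ , v) refl =
        (λ (Pl' , v-on) → Pl' , relabel v (rowWith-column (𝒪 l) k a j) v-on) ,
        (λ (Pl' , v-on) → Pl' , relabel v (sym (rowWith-column (𝒪 l) k a j)) v-on)

      -- a line restricting to β has the trace of β at P₀; its class forces it
      -- over l, and its symbol at P₀ makes it the row indexed by its partner entry
      only : ∀ g → RestrictsTo H ph (P₀ , x₀) g β → ∃[ j ] (row j ≡ g)
      only (l' , r') R with proj₂ (R (P₀ , y) refl) (Pl , y-on)
      ... | (Pl' , y-on') with decL l' l
      ...   | no l'≢l = ⊥-elim (classes-distinct P₀ l' l Pl' Pl l'≢l _ _ (inj₁ λ v →
                (λ v-on → proj₂ (proj₁ (R (P₀ , v) refl) (Pl' , v-on))) ,
                (λ v-on → proj₂ (proj₂ (R (P₀ , v) refl) (Pl , v-on)))))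
      ...   | yes refl =
        OA.entry (𝒪 l) r' (partner k) ,
        cong (l ,_) (subst (λ s → rowWith (𝒪 l) k s (OA.entry (𝒪 l) r' (partner k)) ≡ r')
                           (class-unique P₀ l Pl y _ _ y-on' y-on)
                           (rowWith-entries (𝒪 l) k r'))

  two-uniform : TwoUniform H ph
  two-uniform (P₀ , x₀) =
    Neighbourhood.isAffinePlane P₀ x₀ , suc n , Neighbourhood.restriction-count P₀ x₀

  twoUniformPH : TwoUniformPH H (suc n) (suc n)
  twoUniformPH = ph , neighbour-count , two-uniform

theorem1 : (m : ℕ) → 2 ≤ m →
    (𝒫 : ProjectivePlane m) →
    (𝒜 : ProjectivePlane.Point 𝒫 → AffinePlane m) →
    (𝒪 : ProjectivePlane.Line 𝒫 → OA (suc m) m) →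
    (c : Choices 𝒫 𝒜) → Admissible 𝒫 𝒜 c →
    TwoUniformPH (algorithm 𝒫 𝒜 𝒪 c) m m
theorem1 zero () 𝒫 𝒜 𝒪 c adm
theorem1 (suc n) _ 𝒫 𝒜 𝒪 c adm = Construction.twoUniformPH 𝒫 𝒜 𝒪 c adm
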